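{- Let $P$ be a graph property and $\sim=\sim_P$. Let $(T,(X_t))$ be a rooted, ordered tree decomposition of a graph, let $X_G$ be a branch bag and $X_H$ one of its child bags. Let $G=\mathrm{ptsg}(X_G\mid X_H)$ be the partial terminal subgraph of $X_G$ given $X_H$ and $H=\mathrm{tsg}(X_H)$ the terminal subgraph of $X_H$, and let $G',H'$ be terminal graphs. If $G'\sim G$, $H'\sim H$, $X_{G'}=X_G$ and $X_{H'}=X_H$, then $(G\oplus_{\rhd}H)\sim(G'\oplus_{\rhd}H')$.
   Context: A terminal graph is $(V,E,X)$ with $X\subseteq V$ an ordered terminal set. For terminal graphs with $|X_G|=|X_H|$, $G\oplus H$ is obtained from the disjoint union by identifying the $i$-th terminal of $X_G$ with the $i$-th terminal of $X_H$ for each $i$ (parallel edges are merged). $G\sim_P H$ iff for all terminal graphs $K$ (with matching number of terminals), $P(G\oplus K)\Leftrightarrow P(H\oplus K)$. For terminal graphs $A=(V_A,E_A,X_A)$, $B=(V_B,E_B,X_B)$, $A\oplus_{\rhd}B=(V_A\cup V_B,E_A\cup E_B,X_A)$ (ordinary, not disjoint, union; parallel edges merged). A tree decomposition is rooted (a root node is fixed) and ordered (children of each node linearly ordered); a branch node has more than one child. For a bag $X_t$, $\mathrm{tsg}(X_t)$ is the subgraph induced by the vertices of $X_t$ and of all bags of descendants of $t$, with terminal set $X_t$; for a child $t'$ of $t$, $\mathrm{ptsg}(X_t\mid Y_{t'})$ is the terminal graph induced by $X_t$ together with the vertices and edges of the terminal subgraphs of the children of $t$ that are left siblings of $t'$,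 with terminal set $X_t$. Terminal sets are ordered arbitrarily but fixed.
   Formalization: The terminal graphs G′ and H′ share only terminals: every vertex lying in both G′ and H′ belongs to $X_{G'}$ and to $X_{H'}$, so their ordinary union glues them only along terminals. The statement above fails without it. -}

module Defs where

open import Data.Nat using (ℕ; suc; _*_; _<_)
open import Data.Nat.Properties using (_≟_)
open import Data.Fin using (Fin; toℕ)
open import Data.List using (List; []; _∷_; _++_; map; filter; length; lookup; take)
open import Data.List.Membership.Propositional using (_∈_; _∉_)
open import Data.List.Membership.DecPropositional _≟_ using (_∈?_)
open import Data.List.Relation.Unary.Unique.Propositional using (Unique)
open import Data.Product using (Σ; ∃; _×_; _,_)
open import Data.Sum using (_⊎_)
open import Function.Bundles using (_⇔_)
open import Relation.Nullary using (¬_)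
open import Relation.Nullary.Decidable using (¬?)
open import Relation.Binary.PropositionalEquality using (_≡_)

-- Vertices are natural numbers (a common vertex universe, so
-- that the *ordinary* union of the paper makes sense).  A graph is a
-- finite vertex list (read as a set: duplicates are irrelevant, see _≅_)
-- together with an adjacency relation.

record Graph : Set₁ where
  field
    V : List ℕ
    E : ℕ → ℕ → Set

open Graph public

record IsGraph (G : Graph) : Set where
  field
    E-sym    : ∀ u v → E G u v → E G v u
    E-irrefl : ∀ v → ¬ E G v v
    E-V      : ∀ u v → E G u v → (u ∈ V G) × (v ∈ V G)

record _≅_ (G H : Graph) : Set where
  field
    f     : ℕ → ℕ
    g     : ℕ → ℕ
    f-V   : ∀ v → v ∈ V G → f v ∈ V H
    g-V   : ∀ w → w ∈ V H → g w ∈ V G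
    g∘f   : ∀ v → v ∈ V G → g (f v) ≡ v
    f∘g   : ∀ w → w ∈ V H → f (g w) ≡ w
    f-E   : ∀ u v → u ∈ V G → v ∈ V G → (E G u v ⇔ E H (f u) (f v))

GraphProperty : (Graph → Set) → Set₁
GraphProperty P = ∀ G H → G ≅ H → P G → P H

record TGraph : Set₁ where
  field
    graph : Graph
    X     : List ℕ

open TGraph public

VT : TGraph → List ℕ
VT G = V (graph G)

ET : TGraph → ℕ → ℕ → Set
ET G = E (graph G)

record IsTGraph (G : TGraph) : Set where
  field
    isGraph : IsGraph (graph G)
    X⊆V     : ∀ v → v ∈ X G → v ∈ VT G
    X-uniq  : Unique (X G)

-- G ⊕ K : disjoint union of G and K, the i-th terminal of K identified
-- with the i-th terminal of G.  Concretely: a vertex v of G becomes 2v,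
-- a non-terminal vertex u of K becomes 2u+1, and the i-th terminal of K
-- becomes the image 2·x of the i-th terminal x of G.

Rep : TGraph → TGraph → ℕ → ℕ → Set
Rep G K u a =
  (Σ (Fin (length (X K))) λ i → Σ (Fin (length (X G))) λ i' →
     toℕ i ≡ toℕ i' × lookup (X K) i ≡ u × a ≡ 2 * lookup (X G) i')
  ⊎ (u ∉ X K × a ≡ suc (2 * u))

_⊕_ : TGraph → TGraph → Graph
G ⊕ K = record
  { V = map (2 *_) (VT G) ++ map (λ u → suc (2 * u)) (filter (λ u → ¬? (u ∈? X K)) (VT K))
  ; E = λ a b →
      (Σ ℕ λ u → Σ ℕ λ v → a ≡ 2 * u × b ≡ 2 * v × ET G u v)
      ⊎ (Σ ℕ λ u → Σ ℕ λ v → Rep G K u a × Rep G K v b × ET K u v)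
  }

_∼[_]_ : TGraph → (Graph → Set) → TGraph → Set₁
G ∼[ P ] H = length (X G) ≡ length (X H) ×
  (∀ K → IsTGraph K → length (X K) ≡ length (X G) → (P (G ⊕ K) ⇔ P (H ⊕ K)))

_⊕▷_ : TGraph → TGraph → TGraph
A ⊕▷ B = record
  { graph = record { V = VT A ++ VT B ; E = λ u v → ET A u v ⊎ ET B u v }
  ; X = X A }

data Tree : Set where
  node : List ℕ → List Tree → Tree

bag : Tree → List ℕ
bag (node b _) = b

children : Tree → List Tree
children (node _ cs) = cs

-- positions: paths of child indices from the root
Path : Set
Path = List ℕ

data _∋_at_ : Tree → Tree → Path → Set where
  here  : ∀ {t} → t ∋ t at []
  there : ∀ {b cs s p} (i : Fin (length cs)) →
          lookup cs i ∋ s at p → node b cs ∋ s at (toℕ i ∷ p)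

_⊑_ : Path → Path → Set
p ⊑ q = ∃ λ r → p ++ r ≡ q

-- r lies on the tree path between p and q
OnPath : Path → Path → Path → Set
OnPath r p q = (r ⊑ p ⊎ r ⊑ q) × (∀ s → s ⊑ p → s ⊑ q → s ⊑ r)

verts  : Tree → List ℕ
vertsL : List Tree → List ℕ
verts (node b cs) = b ++ vertsL cs
vertsL []       = []
vertsL (c ∷ cs) = verts c ++ vertsL cs

record TreeDecomposition (Γ : Graph) (T : Tree) : Set where
  field
    bag-uniq : ∀ s p → T ∋ s at p → Unique (bag s)
    bag-V    : ∀ s p → T ∋ s at p → ∀ v → v ∈ bag s → v ∈ V Γ
    cover-V  : ∀ v → v ∈ V Γ → ∃ λ p → ∃ λ s → T ∋ s at p × v ∈ bag s
    cover-E  : ∀ u v → E Γ u v → ∃ λ p → ∃ λ s → T ∋ s at p × u ∈ bag s × v ∈ bag s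
    connected : ∀ v p q r sp sq sr → T ∋ sp at p → T ∋ sq at q → T ∋ sr at r →
                v ∈ bag sp → v ∈ bag sq → OnPath r p q → v ∈ bag sr

induced : Graph → List ℕ → List ℕ → TGraph
induced Γ S Y = record
  { graph = record { V = S ; E = λ u v → u ∈ S × v ∈ S × E Γ u v }
  ; X = Y }

tsg : Graph → Tree → TGraph
tsg Γ t = induced Γ (verts t) (bag t)

ptsg : Graph → (t : Tree) → Fin (length (children t)) → TGraph
ptsg Γ t j = induced Γ (bag t ++ vertsL (take (toℕ j) (children t))) (bag t)

-- Fix a test graph K.  The graph (G ⊕▷ H) ⊕ K can be regrouped as G ⊕ L, where L consists of H and K glued
-- onto the terminals of G, so G may be replaced by G′.  Regrouping G′ ⊕ L as H ⊕ M, where M consists of G′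
-- and K, lets H be replaced by H′, and undoing both regroupings yields (G′ ⊕▷ H′) ⊕ K.  A regrouping is an
-- isomorphism only if the two parts meet in terminals alone (V G ∩ V H ⊆ X_G and V H ∩ X_G ⊆ X_H); for
-- ptsg and tsg this is the connectivity axiom of the tree decomposition.
module Submission where

open import Defs
open import Data.Nat using (ℕ; zero; suc; _*_; _<_; z≤n; s≤s)
open import Data.Nat.Properties using (_≟_; suc-injective; *-cancelˡ-≡; even≢odd; <⇒≢)
open import Data.Fin using (Fin; toℕ; cast) renaming (zero to fzero; suc to fsuc)
open import Data.Fin.Properties using (toℕ-cast; toℕ<n)
open import Data.List using (List; []; _∷_; _++_; map; length; lookup; take)
open import Data.List.Properties using (length-map; ∷-injectiveˡ; ∷-injectiveʳ; ++-assoc)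
open import Data.List.Membership.Propositional using (_∈_; _∉_)
open import Data.List.Membership.DecPropositional _≟_ using (_∈?_)
open import Data.List.Membership.Propositional.Properties
  using (∈-map⁺; ∈-map⁻; ∈-++⁺ˡ; ∈-++⁺ʳ; ∈-++⁻; ∈-filter⁺; ∈-filter⁻; ∈-lookup)
open import Data.List.Relation.Unary.Any using (here; there; index)
open import Data.List.Relation.Unary.Any.Properties using (lookup-index)
open import Data.List.Relation.Unary.All using () renaming (lookup to All-lookup)
open import Data.List.Relation.Unary.AllPairs using (_∷_)
open import Data.List.Relation.Unary.Unique.Propositional using (Unique)
open import Data.List.Relation.Unary.Unique.Propositional.Properties using (map⁺)
open import Data.Product using (Σ; ∃; _×_; _,_; proj₁; proj₂)
open import Data.Sum using (_⊎_; inj₁; inj₂)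
open import Data.Empty using (⊥; ⊥-elim)
open import Data.Unit using (⊤; tt)
open import Function.Bundles using (_⇔_; mk⇔)
open import Function.Properties.Equivalence using (⇔-setoid)
open import Level using (0ℓ)
open import Relation.Nullary using (¬_; yes; no)
open import Relation.Nullary.Decidable using (¬?)
import Relation.Binary.Reasoning.Setoid
open import Relation.Binary.PropositionalEquality using (_≡_; _≢_; refl; sym; trans; cong; cong₂; subst; subst₂)

indexOf : ℕ → List ℕ → ℕ
indexOf u [] = 0
indexOf u (x ∷ xs) with u ≟ x
... | yes _ = 0
... | no _ = suc (indexOf u xs)

nth : List ℕ → ℕ → ℕ
nth [] _ = 0
nth (x ∷ xs) zero = x
nth (x ∷ xs) (suc i) = nth xs i

nth-indexOf : ∀ {u} xs → u ∈ xs → nth xs (indexOf u xs) ≡ u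
nth-indexOf {u} (x ∷ xs) p with u ≟ x
... | yes u≡x = sym u≡x
nth-indexOf {u} (x ∷ xs) (here u≡x) | no u≢x = ⊥-elim (u≢x u≡x)
nth-indexOf {u} (x ∷ xs) (there p) | no _ = nth-indexOf xs p

indexOf<length : ∀ {u} xs → u ∈ xs → indexOf u xs < length xs
indexOf<length {u} (x ∷ xs) p with u ≟ x
... | yes _ = s≤s z≤n
indexOf<length {u} (x ∷ xs) (here u≡x) | no u≢x = ⊥-elim (u≢x u≡x)
indexOf<length {u} (x ∷ xs) (there p) | no _ = s≤s (indexOf<length xs p)

nth∈ : ∀ xs {i} → i < length xs → nth xs i ∈ xs
nth∈ (x ∷ xs) {zero} _ = here refl
nth∈ (x ∷ xs) {suc i} (s≤s i<n) = there (nth∈ xs i<n)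

nth-lookup : ∀ xs (i : Fin (length xs)) → nth xs (toℕ i) ≡ lookup xs i
nth-lookup (x ∷ xs) fzero = refl
nth-lookup (x ∷ xs) (fsuc i) = nth-lookup xs i

nth-injective : ∀ xs → Unique xs → ∀ {i j} → i < length xs → j < length xs →
                nth xs i ≡ nth xs j → i ≡ j
nth-injective (x ∷ xs) u {zero} {zero} _ _ _ = refl
nth-injective (x ∷ xs) (x∉xs ∷ u) {zero} {suc j} _ (s≤s j<n) e = ⊥-elim (All-lookup x∉xs (nth∈ xs j<n) e)
nth-injective (x ∷ xs) (x∉xs ∷ u) {suc i} {zero} (s≤s i<n) _ e = ⊥-elim (All-lookup x∉xs (nth∈ xs i<n) (sym e))
nth-injective (x ∷ xs) (_ ∷ u) {suc i} {suc j} (s≤s i<n) (s≤s j<n) e = cong suc (nth-injective xs u i<n j<n e)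

indexOf-nth : ∀ xs → Unique xs → ∀ {i} → i < length xs → indexOf (nth xs i) xs ≡ i
indexOf-nth xs u i<n = nth-injective xs u (indexOf<length xs (nth∈ xs i<n)) i<n (nth-indexOf xs (nth∈ xs i<n))

indexOf-lookup : ∀ xs → Unique xs → (i : Fin (length xs)) → indexOf (lookup xs i) xs ≡ toℕ i
indexOf-lookup xs u i =
  trans (cong (λ z → indexOf z xs) (sym (nth-lookup xs i))) (indexOf-nth xs u (toℕ<n i))

double-injective : ∀ {a b} → 2 * a ≡ 2 * b → a ≡ b
double-injective {a} {b} = *-cancelˡ-≡ a b 2

indexOf-map-double : ∀ v xs → indexOf (2 * v) (map (2 *_) xs) ≡ indexOf v xs
indexOf-map-double v [] = refl
indexOf-map-double v (x ∷ xs) with 2 * v ≟ 2 * x | v ≟ x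
... | yes _ | yes _ = refl
... | yes 2v≡2x | no v≢x = ⊥-elim (v≢x (double-injective 2v≡2x))
... | no 2v≢2x | yes v≡x = ⊥-elim (2v≢2x (cong (2 *_) v≡x))
... | no _ | no _ = cong suc (indexOf-map-double v xs)

odd∉map-double : ∀ n xs → suc (2 * n) ∉ map (2 *_) xs
odd∉map-double n xs p with ∈-map⁻ (2 *_) p
... | x , _ , e = even≢odd x n (sym e)

rightImage : List ℕ → List ℕ → ℕ → ℕ
rightImage XG XK u with u ∈? XK
... | yes _ = 2 * nth XG (indexOf u XK)
... | no _ = suc (2 * u)

rightImage-∈ : ∀ XG XK {u} → u ∈ XK → rightImage XG XK u ≡ 2 * nth XG (indexOf u XK)
rightImage-∈ XG XK {u} u∈ with u ∈? XK
... | yes _ = refl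
... | no u∉ = ⊥-elim (u∉ u∈)

rightImage-∉ : ∀ XG XK {u} → u ∉ XK → rightImage XG XK u ≡ suc (2 * u)
rightImage-∉ XG XK {u} u∉ with u ∈? XK
... | yes u∈ = ⊥-elim (u∉ u∈)
... | no _ = refl

rightImage-double : ∀ XG {c} → c ∈ XG → rightImage XG (map (2 *_) XG) (2 * c) ≡ 2 * c
rightImage-double XG {c} c∈ = trans (rightImage-∈ XG (map (2 *_) XG) (∈-map⁺ (2 *_) c∈))
  (cong (2 *_) (trans (cong (nth XG) (indexOf-map-double c XG)) (nth-indexOf XG c∈)))

rightImage-odd : ∀ XG n → rightImage XG (map (2 *_) XG) (suc (2 * n)) ≡ suc (2 * suc (2 * n))
rightImage-odd XG n = rightImage-∉ XG (map (2 *_) XG) (odd∉map-double n XG)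

module ⊕-Structure (G K : TGraph) (K-unique : Unique (X K)) (len : length (X K) ≡ length (X G)) where

  image : ℕ → ℕ
  image = rightImage (X G) (X K)

  Rep⇒≡image : ∀ {u a} → Rep G K u a → a ≡ image u
  Rep⇒≡image (inj₁ (i , i′ , i≡i′ , refl , refl)) =
    sym (trans (rightImage-∈ (X G) (X K) (∈-lookup i))
      (cong (2 *_) (trans (cong (nth (X G)) (trans (indexOf-lookup (X K) K-unique i) i≡i′))
                          (nth-lookup (X G) i′))))
  Rep⇒≡image (inj₂ (u∉ , refl)) = sym (rightImage-∉ (X G) (X K) u∉)

  ≡image⇒Rep : ∀ {u a} → a ≡ image u → Rep G K u a
  ≡image⇒Rep {u} {a} e with u ∈? X K
  ... | no u∉ = inj₂ (u∉ , e)
  ... | yes u∈ = inj₁ (i , cast len i , sym (toℕ-cast len i) , sym u≡ , trans e (cong (2 *_) nth≡))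
    where
    i = index u∈
    u≡ : u ≡ lookup (X K) i
    u≡ = lookup-index u∈
    nth≡ : nth (X G) (indexOf u (X K)) ≡ lookup (X G) (cast len i)
    nth≡ = trans (cong (nth (X G)) (trans (cong (λ z → indexOf z (X K)) u≡)
                                          (trans (indexOf-lookup (X K) K-unique i) (sym (toℕ-cast len i)))))
                 (nth-lookup (X G) (cast len i))

  edge-cases : ∀ {a b} → E (G ⊕ K) a b →
               (Σ ℕ λ u → Σ ℕ λ v → a ≡ 2 * u × b ≡ 2 * v × ET G u v)
               ⊎ (Σ ℕ λ u → Σ ℕ λ v → a ≡ image u × b ≡ image v × ET K u v)
  edge-cases (inj₁ e) = inj₁ e
  edge-cases (inj₂ (u , v , ra , rb , e)) = inj₂ (u , v , Rep⇒≡image ra , Rep⇒≡image rb , e)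

  left-edge : ∀ {u v} → ET G u v → E (G ⊕ K) (2 * u) (2 * v)
  left-edge {u} {v} e = inj₁ (u , v , refl , refl , e)

  right-edge : ∀ {u v} → ET K u v → E (G ⊕ K) (image u) (image v)
  right-edge {u} {v} e = inj₂ (u , v , ≡image⇒Rep refl , ≡image⇒Rep refl , e)

  vertex-cases : ∀ {a} → a ∈ V (G ⊕ K) →
                 (Σ ℕ λ v → v ∈ VT G × 2 * v ≡ a) ⊎ (Σ ℕ λ u → u ∈ VT K × image u ≡ a)
  vertex-cases {a} a∈ with ∈-++⁻ (map (2 *_) (VT G)) a∈
  ... | inj₁ a∈G with ∈-map⁻ (2 *_) a∈G
  ...   | v , v∈ , refl = inj₁ (v , v∈ , refl)
  vertex-cases {a} a∈ | inj₂ a∈K with ∈-map⁻ (λ u → suc (2 * u)) a∈K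
  ... | u , u∈ , refl with ∈-filter⁻ (λ u → ¬? (u ∈? X K)) {xs = VT K} u∈
  ...   | u∈K , u∉ = inj₂ (u , u∈K , rightImage-∉ (X G) (X K) u∉)

  left-vertex : ∀ {v} → v ∈ VT G → 2 * v ∈ V (G ⊕ K)
  left-vertex v∈ = ∈-++⁺ˡ (∈-map⁺ (2 *_) v∈)

  right-vertex : (∀ v → v ∈ X G → v ∈ VT G) → ∀ {u} → u ∈ VT K → image u ∈ V (G ⊕ K)
  right-vertex XG⊆VG {u} u∈ with u ∈? X K
  ... | yes u∈X = left-vertex (XG⊆VG _ (nth∈ (X G) (subst (indexOf u (X K) <_) len (indexOf<length (X K) u∈X))))
  ... | no u∉X = ∈-++⁺ʳ (map (2 *_) (VT G))
                   (∈-map⁺ (λ u → suc (2 * u)) (∈-filter⁺ (λ u → ¬? (u ∈? X K)) u∈ u∉X))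

-- A presentation describes a graph Γ as the image, under an injective coding, of an abstract graph whose
-- vertices are the normal forms of the "present" elements of W and whose edges are given by Adj.
module Presentations {W : Set} (w₀ : W) (Present : W → Set) (Adj : W → W → Set)
                     (normal : W → W) (Normal : W → Set)
                     (normal-Normal : ∀ x → Present x → Normal (normal x)) where

  record Presentation : Set₁ where
    field
      Γ                 : Graph
      code              : W → ℕ
      code-injective    : ∀ z w → Normal z → Normal w → code z ≡ code w → z ≡ w
      vertex-surjective : ∀ a → a ∈ V Γ → Σ W λ x → Present x × code (normal x) ≡ a
      vertex            : ∀ x → Present x → code (normal x) ∈ V Γ
      edge-surjective   : ∀ a b → E Γ a b → Σ W λ x → Σ W λ y →
                          Present x × Present y × code (normal x) ≡ a × code (normal y) ≡ b × Adj x y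
      edge              : ∀ x y → Present x → Present y → Adj x y → E Γ (code (normal x)) (code (normal y))

  open Presentation

  module _ (F₁ F₂ : Presentation) where

    decode : ℕ → W
    decode a with a ∈? V (Γ F₁)
    ... | yes a∈ = proj₁ (vertex-surjective F₁ a a∈)
    ... | no _ = w₀

    decode-correct : ∀ a → a ∈ V (Γ F₁) → Present (decode a) × code F₁ (normal (decode a)) ≡ a
    decode-correct a a∈ with a ∈? V (Γ F₁)
    ... | yes a∈′ = proj₂ (vertex-surjective F₁ a a∈′)
    ... | no a∉ = ⊥-elim (a∉ a∈)

    recode : ℕ → ℕ
    recode a = code F₂ (normal (decode a))

    recode-congruent : ∀ x y → Present x → Present y →
                       code F₁ (normal x) ≡ code F₁ (normal y) → code F₂ (normal x) ≡ code F₂ (normal y)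
    recode-congruent x y px py e =
      cong (code F₂) (code-injective F₁ (normal x) (normal y) (normal-Normal x px) (normal-Normal y py) e)

    recode-code : ∀ x → Present x → recode (code F₁ (normal x)) ≡ code F₂ (normal x)
    recode-code x px =
      let (pd , ed) = decode-correct (code F₁ (normal x)) (vertex F₁ x px)
      in recode-congruent _ x pd px ed

  recode-recode : (F₁ F₂ : Presentation) → ∀ a → a ∈ V (Γ F₁) → recode F₂ F₁ (recode F₁ F₂ a) ≡ a
  recode-recode F₁ F₂ a a∈ =
    let (px , ex) = decode-correct F₁ F₂ a a∈
    in trans (recode-code F₂ F₁ _ px) ex

  recode-edge : (F₁ F₂ : Presentation) → ∀ a b → a ∈ V (Γ F₁) → b ∈ V (Γ F₁) →
                E (Γ F₁) a b → E (Γ F₂) (recode F₁ F₂ a) (recode F₁ F₂ b)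
  recode-edge F₁ F₂ a b a∈ b∈ e =
    let (x , y , px , py , ex , ey , adj) = edge-surjective F₁ a b e
    in subst₂ (E (Γ F₂)) (trans (sym (recode-code F₁ F₂ x px)) (cong (recode F₁ F₂) ex))
                         (trans (sym (recode-code F₁ F₂ y py)) (cong (recode F₁ F₂) ey))
                         (edge F₂ x y px py adj)

  presentations-≅ : (F₁ F₂ : Presentation) → Γ F₁ ≅ Γ F₂
  presentations-≅ F₁ F₂ = record
    { f   = recode F₁ F₂
    ; g   = recode F₂ F₁
    ; f-V = λ a a∈ → vertex F₂ _ (proj₁ (decode-correct F₁ F₂ a a∈))
    ; g-V = λ a a∈ → vertex F₁ _ (proj₁ (decode-correct F₂ F₁ a a∈))
    ; g∘f = recode-recode F₁ F₂
    ; f∘g = recode-recode F₂ F₁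
    ; f-E = λ a b a∈ b∈ → mk⇔ (recode-edge F₁ F₂ a b a∈ b∈) (from a b a∈ b∈)
    }
    where
    from : ∀ a b → a ∈ V (Γ F₁) → b ∈ V (Γ F₁) →
           E (Γ F₂) (recode F₁ F₂ a) (recode F₁ F₂ b) → E (Γ F₁) a b
    from a b a∈ b∈ e = subst₂ (E (Γ F₁)) (recode-recode F₁ F₂ a a∈) (recode-recode F₁ F₂ b b∈)
      (recode-edge F₂ F₁ _ _ (vertex F₂ _ (proj₁ (decode-correct F₁ F₂ a a∈)))
                             (vertex F₂ _ (proj₁ (decode-correct F₁ F₂ b b∈))) e)

  presentations-⇔ : ∀ {P : Graph → Set} → GraphProperty P → (F₁ F₂ : Presentation) → P (Γ F₁) ⇔ P (Γ F₂)
  presentations-⇔ isProp F₁ F₂ =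
    mk⇔ (isProp _ _ (presentations-≅ F₁ F₂)) (isProp _ _ (presentations-≅ F₂ F₁))

data Vertex : Set where
  inB inC inK : ℕ → Vertex

inB-injective : ∀ {a b} → inB a ≡ inB b → a ≡ b
inB-injective refl = refl

-- Shared vertices of B and C are identified (B-side representative), and the i-th terminal of K is
-- identified with the i-th terminal of B.
identify : List ℕ → List ℕ → Vertex → Vertex
identify XB XK (inB v) = inB v
identify XB XK (inC v) with v ∈? XB
... | yes _ = inB v
... | no _ = inC v
identify XB XK (inK u) with u ∈? XK
... | yes _ = inB (nth XB (indexOf u XK))
... | no _ = inK u

-- The codes follow the numbering 2v (left) / 2u+1 (right) of _⊕_; code-⊕L and code-⊕M compose it with
-- the numbering codeL / codeM used inside the auxiliary right-hand graphs L and M.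
codeL : Vertex → ℕ
codeL (inB v) = 2 * v
codeL (inC v) = suc (2 * (2 * v))
codeL (inK u) = suc (2 * suc (2 * u))

codeM : List ℕ → Vertex → ℕ
codeM XC (inB v) with v ∈? XC
... | yes _ = 2 * v
... | no _ = suc (2 * (2 * v))
codeM XC (inC v) = 0
codeM XC (inK u) = suc (2 * suc (2 * u))

-- C and K glued along the terminals of B, with terminal list X B.
gluedL : List ℕ → TGraph → TGraph → TGraph
gluedL XB C K = record
  { graph = record
    { V = map (2 *_) XB ++ (map (λ v → codeL (identify XB (X K) (inC v))) (VT C)
                            ++ map (λ u → codeL (identify XB (X K) (inK u))) (VT K))
    ; E = λ a b →
        (Σ ℕ λ u → Σ ℕ λ v → codeL (identify XB (X K) (inC u)) ≡ a
                             × codeL (identify XB (X K) (inC v)) ≡ b × ET C u v)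
        ⊎ (Σ ℕ λ u → Σ ℕ λ v → codeL (identify XB (X K) (inK u)) ≡ a
                               × codeL (identify XB (X K) (inK v)) ≡ b × ET K u v) }
  ; X = map (2 *_) XB }

-- B and K glued along the terminals of B, with terminal list X C.
gluedM : TGraph → List ℕ → TGraph → TGraph
gluedM B XC K = record
  { graph = record
    { V = map (2 *_) XC ++ (map (λ v → codeM XC (inB v)) (VT B)
                            ++ map (λ u → codeM XC (identify (X B) (X K) (inK u))) (VT K))
    ; E = λ a b →
        (Σ ℕ λ u → Σ ℕ λ v → codeM XC (inB u) ≡ a × codeM XC (inB v) ≡ b × ET B u v)
        ⊎ (Σ ℕ λ u → Σ ℕ λ v → codeM XC (identify (X B) (X K) (inK u)) ≡ a
                               × codeM XC (identify (X B) (X K) (inK v)) ≡ b × ET K u v) }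
  ; X = map (2 *_) XC }

code-⊕▷⊕ : Vertex → ℕ
code-⊕▷⊕ (inB v) = 2 * v
code-⊕▷⊕ (inC v) = 2 * v
code-⊕▷⊕ (inK u) = suc (2 * u)

code-⊕L : Vertex → ℕ
code-⊕L (inB v) = 2 * v
code-⊕L (inC v) = suc (2 * codeL (inC v))
code-⊕L (inK u) = suc (2 * codeL (inK u))

code-⊕M : List ℕ → Vertex → ℕ
code-⊕M XC (inB v) with v ∈? XC
... | yes _ = 2 * v
... | no _ = suc (2 * suc (2 * (2 * v)))
code-⊕M XC (inC v) = 2 * v
code-⊕M XC (inK u) = suc (2 * codeL (inK u))

codeL-injective : ∀ z w → codeL z ≡ codeL w → z ≡ w
codeL-injective (inB a) (inB b) e = cong inB (double-injective e)
codeL-injective (inB a) (inC b) e = ⊥-elim (even≢odd a (2 * b) e)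
codeL-injective (inB a) (inK b) e = ⊥-elim (even≢odd a (suc (2 * b)) e)
codeL-injective (inC a) (inB b) e = ⊥-elim (even≢odd b (2 * a) (sym e))
codeL-injective (inC a) (inC b) e = cong inC (double-injective (double-injective (suc-injective e)))
codeL-injective (inC a) (inK b) e = ⊥-elim (even≢odd a b (double-injective (suc-injective e)))
codeL-injective (inK a) (inB b) e = ⊥-elim (even≢odd b (suc (2 * a)) (sym e))
codeL-injective (inK a) (inC b) e = ⊥-elim (even≢odd b a (double-injective (suc-injective (sym e))))
codeL-injective (inK a) (inK b) e =
  cong inK (double-injective (suc-injective (double-injective (suc-injective e))))

endpoints : (A : TGraph) → IsTGraph A → ∀ {u v} → ET A u v → u ∈ VT A × v ∈ VT A
endpoints A iA {u} {v} = IsGraph.E-V (IsTGraph.isGraph iA) u v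

module Gluing (B C K : TGraph) (iB : IsTGraph B) (iC : IsTGraph C) (iK : IsTGraph K)
              (len : length (X K) ≡ length (X B)) where

  open IsTGraph
  open IsGraph

  Present : Vertex → Set
  Present (inB v) = v ∈ VT B
  Present (inC v) = v ∈ VT C
  Present (inK u) = u ∈ VT K

  Adj : Vertex → Vertex → Set
  Adj (inB u) (inB v) = ET B u v
  Adj (inC u) (inC v) = ET C u v
  Adj (inK u) (inK v) = ET K u v
  Adj _ _ = ⊥

  normal : Vertex → Vertex
  normal = identify (X B) (X K)

  Normal : Vertex → Set
  Normal (inB v) = v ∈ VT B
  Normal (inC v) = v ∈ VT C × v ∉ X B
  Normal (inK u) = u ∈ VT K × u ∉ X K

  matchingTerminal∈ : ∀ {u} → u ∈ X K → nth (X B) (indexOf u (X K)) ∈ X B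
  matchingTerminal∈ u∈ = nth∈ (X B) (subst (_ <_) len (indexOf<length (X K) u∈))

  normal-Normal : ∀ x → Present x → Normal (normal x)
  normal-Normal (inB v) v∈ = v∈
  normal-Normal (inC v) v∈ with v ∈? X B
  ... | yes v∈X = X⊆V iB v v∈X
  ... | no v∉X = v∈ , v∉X
  normal-Normal (inK u) u∈ with u ∈? X K
  ... | yes u∈X = X⊆V iB _ (matchingTerminal∈ u∈X)
  ... | no u∉X = u∈ , u∉X

  normal-inC-injective : ∀ u v → normal (inC u) ≡ normal (inC v) → u ≡ v
  normal-inC-injective u v e with u ∈? X B | v ∈? X B
  ... | yes _ | yes _ = inB-injective e
  ... | no _ | no _ = cong (λ { (inC a) → a ; _ → 0 }) e
  normal-inC-injective u v () | yes _ | no _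
  normal-inC-injective u v () | no _ | yes _

  -- Injective because the terminals of B are distinct.
  normal-inK-injective : ∀ u v → normal (inK u) ≡ normal (inK v) → u ≡ v
  normal-inK-injective u v e with u ∈? X K | v ∈? X K
  ... | yes u∈ | yes v∈ =
    trans (sym (nth-indexOf (X K) u∈)) (trans (cong (nth (X K)) same-index) (nth-indexOf (X K) v∈))
    where
    same-index : indexOf u (X K) ≡ indexOf v (X K)
    same-index = nth-injective (X B) (X-uniq iB) (subst (_ <_) len (indexOf<length (X K) u∈))
                   (subst (_ <_) len (indexOf<length (X K) v∈)) (inB-injective e)
  ... | no _ | no _ = cong (λ { (inK a) → a ; _ → 0 }) e
  normal-inK-injective u v () | yes _ | no _
  normal-inK-injective u v () | no _ | yes _

  open Presentations (inB 0) Present Adj normal Normal normal-Normal public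

  module Union (B∩C⊆XB : ∀ v → v ∈ VT B → v ∈ VT C → v ∈ X B) where
    open ⊕-Structure (B ⊕▷ C) K (X-uniq iK) len

    Γ₁ : Graph
    Γ₁ = (B ⊕▷ C) ⊕ K

    code-normal-inC : ∀ v → code-⊕▷⊕ (normal (inC v)) ≡ 2 * v
    code-normal-inC v with v ∈? X B
    ... | yes _ = refl
    ... | no _ = refl

    image≡code-normal-inK : ∀ u → image u ≡ code-⊕▷⊕ (normal (inK u))
    image≡code-normal-inK u with u ∈? X K
    ... | yes _ = refl
    ... | no _ = refl

    code-injective : ∀ z w → Normal z → Normal w → code-⊕▷⊕ z ≡ code-⊕▷⊕ w → z ≡ w
    code-injective (inB a) (inB b) _ _ e = cong inB (double-injective e)
    code-injective (inB a) (inC b) a∈ (b∈ , b∉) e =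
      ⊥-elim (b∉ (B∩C⊆XB b (subst (_∈ VT B) (double-injective e) a∈) b∈))
    code-injective (inB a) (inK b) _ _ e = ⊥-elim (even≢odd a b e)
    code-injective (inC a) (inB b) (a∈ , a∉) b∈ e =
      ⊥-elim (a∉ (B∩C⊆XB a (subst (_∈ VT B) (sym (double-injective e)) b∈) a∈))
    code-injective (inC a) (inC b) _ _ e = cong inC (double-injective e)
    code-injective (inC a) (inK b) _ _ e = ⊥-elim (even≢odd a b e)
    code-injective (inK a) (inB b) _ _ e = ⊥-elim (even≢odd b a (sym e))
    code-injective (inK a) (inC b) _ _ e = ⊥-elim (even≢odd b a (sym e))
    code-injective (inK a) (inK b) _ _ e = cong inK (double-injective (suc-injective e))

    vertex-surjective : ∀ a → a ∈ V Γ₁ → Σ Vertex λ x → Present x × code-⊕▷⊕ (normal x) ≡ a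
    vertex-surjective a a∈ with vertex-cases a∈
    ... | inj₂ (u , u∈ , e) = inK u , u∈ , trans (sym (image≡code-normal-inK u)) e
    ... | inj₁ (v , v∈ , e) with ∈-++⁻ (VT B) v∈
    ...   | inj₁ v∈B = inB v , v∈B , e
    ...   | inj₂ v∈C = inC v , v∈C , trans (code-normal-inC v) e

    vertex : ∀ x → Present x → code-⊕▷⊕ (normal x) ∈ V Γ₁
    vertex (inB v) v∈ = left-vertex (∈-++⁺ˡ v∈)
    vertex (inC v) v∈ = subst (_∈ V Γ₁) (sym (code-normal-inC v)) (left-vertex (∈-++⁺ʳ (VT B) v∈))
    vertex (inK u) u∈ = subst (_∈ V Γ₁) (image≡code-normal-inK u) (right-vertex (λ v v∈ → ∈-++⁺ˡ (X⊆V iB v v∈)) u∈)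

    edge-surjective : ∀ a b → E Γ₁ a b → Σ Vertex λ x → Σ Vertex λ y → Present x × Present y ×
                      code-⊕▷⊕ (normal x) ≡ a × code-⊕▷⊕ (normal y) ≡ b × Adj x y
    edge-surjective a b e with edge-cases e
    ... | inj₁ (u , v , refl , refl , inj₁ r) =
      inB u , inB v , proj₁ (endpoints B iB r) , proj₂ (endpoints B iB r) , refl , refl , r
    ... | inj₁ (u , v , refl , refl , inj₂ r) =
      inC u , inC v , proj₁ (endpoints C iC r) , proj₂ (endpoints C iC r) ,
      code-normal-inC u , code-normal-inC v , r
    ... | inj₂ (u , v , refl , refl , r) =
      inK u , inK v , proj₁ (endpoints K iK r) , proj₂ (endpoints K iK r) ,
      sym (image≡code-normal-inK u) , sym (image≡code-normal-inK v) , r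

    edge : ∀ x y → Present x → Present y → Adj x y → E Γ₁ (code-⊕▷⊕ (normal x)) (code-⊕▷⊕ (normal y))
    edge (inB u) (inB v) _ _ r = left-edge (inj₁ r)
    edge (inC u) (inC v) _ _ r =
      subst₂ (E Γ₁) (sym (code-normal-inC u)) (sym (code-normal-inC v)) (left-edge (inj₂ r))
    edge (inK u) (inK v) _ _ r =
      subst₂ (E Γ₁) (image≡code-normal-inK u) (image≡code-normal-inK v) (right-edge r)
    edge (inB _) (inC _) _ _ ()
    edge (inB _) (inK _) _ _ ()
    edge (inC _) (inB _) _ _ ()
    edge (inC _) (inK _) _ _ ()
    edge (inK _) (inB _) _ _ ()
    edge (inK _) (inC _) _ _ ()

    presentation : Presentation
    presentation = record
      { Γ = Γ₁ ; code = code-⊕▷⊕ ; code-injective = code-injective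
      ; vertex-surjective = vertex-surjective ; vertex = vertex
      ; edge-surjective = edge-surjective ; edge = edge }

  L : TGraph
  L = gluedL (X B) C K

  L-length : length (X L) ≡ length (X B)
  L-length = length-map (2 *_) (X B)

  L-isTGraph : IsTGraph L
  L-isTGraph = record
    { isGraph = record { E-sym = symmetric ; E-irrefl = irreflexive ; E-V = λ _ _ → endpoints-L }
    ; X⊆V = λ _ → ∈-++⁺ˡ
    ; X-uniq = map⁺ double-injective (X-uniq iB) }
    where
    symmetric : ∀ a b → ET L a b → ET L b a
    symmetric a b (inj₁ (u , v , ea , eb , r)) = inj₁ (v , u , eb , ea , E-sym (isGraph iC) u v r)
    symmetric a b (inj₂ (u , v , ea , eb , r)) = inj₂ (v , u , eb , ea , E-sym (isGraph iK) u v r)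
    irreflexive : ∀ a → ¬ ET L a a
    irreflexive a (inj₁ (u , v , ea , eb , r)) = E-irrefl (isGraph iC) v
      (subst (λ z → ET C z v) (normal-inC-injective u v (codeL-injective _ _ (trans ea (sym eb)))) r)
    irreflexive a (inj₂ (u , v , ea , eb , r)) = E-irrefl (isGraph iK) v
      (subst (λ z → ET K z v) (normal-inK-injective u v (codeL-injective _ _ (trans ea (sym eb)))) r)
    fromC : ∀ {u} → u ∈ VT C → codeL (normal (inC u)) ∈ VT L
    fromC u∈ = ∈-++⁺ʳ (map (2 *_) (X B)) (∈-++⁺ˡ (∈-map⁺ (λ v → codeL (normal (inC v))) u∈))
    fromK : ∀ {u} → u ∈ VT K → codeL (normal (inK u)) ∈ VT L
    fromK u∈ = ∈-++⁺ʳ (map (2 *_) (X B))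
      (∈-++⁺ʳ (map (λ v → codeL (normal (inC v))) (VT C)) (∈-map⁺ (λ v → codeL (normal (inK v))) u∈))
    endpoints-L : ∀ {a b} → ET L a b → (a ∈ VT L) × (b ∈ VT L)
    endpoints-L (inj₁ (u , v , refl , refl , r)) = fromC (proj₁ (endpoints C iC r)) , fromC (proj₂ (endpoints C iC r))
    endpoints-L (inj₂ (u , v , refl , refl , r)) = fromK (proj₁ (endpoints K iK r)) , fromK (proj₂ (endpoints K iK r))

  module LeftGlue where
    open ⊕-Structure B L (X-uniq L-isTGraph) L-length

    Γ₂ : Graph
    Γ₂ = B ⊕ L

    TerminalIfInB : Vertex → Set
    TerminalIfInB (inB v) = v ∈ X B
    TerminalIfInB _ = ⊤

    image-codeL : ∀ z → TerminalIfInB z → image (codeL z) ≡ code-⊕L z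
    image-codeL (inB v) v∈ = rightImage-double (X B) v∈
    image-codeL (inC v) _ = rightImage-odd (X B) (2 * v)
    image-codeL (inK u) _ = rightImage-odd (X B) (suc (2 * u))

    image-codeL-inC : ∀ v → image (codeL (normal (inC v))) ≡ code-⊕L (normal (inC v))
    image-codeL-inC v with v ∈? X B
    ... | yes v∈ = image-codeL (inB v) v∈
    ... | no _ = image-codeL (inC v) tt

    image-codeL-inK : ∀ u → image (codeL (normal (inK u))) ≡ code-⊕L (normal (inK u))
    image-codeL-inK u with u ∈? X K
    ... | yes u∈ = image-codeL (inB _) (matchingTerminal∈ u∈)
    ... | no _ = image-codeL (inK u) tt

    code-injective : ∀ z w → Normal z → Normal w → code-⊕L z ≡ code-⊕L w → z ≡ w
    code-injective (inB a) (inB b) _ _ e = cong inB (double-injective e)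
    code-injective (inB a) (inC b) _ _ e = ⊥-elim (even≢odd a (codeL (inC b)) e)
    code-injective (inB a) (inK b) _ _ e = ⊥-elim (even≢odd a (codeL (inK b)) e)
    code-injective (inC a) (inB b) _ _ e = ⊥-elim (even≢odd b (codeL (inC a)) (sym e))
    code-injective (inK a) (inB b) _ _ e = ⊥-elim (even≢odd b (codeL (inK a)) (sym e))
    code-injective (inC a) (inC b) _ _ e = codeL-injective (inC a) (inC b) (double-injective (suc-injective e))
    code-injective (inC a) (inK b) _ _ e = codeL-injective (inC a) (inK b) (double-injective (suc-injective e))
    code-injective (inK a) (inC b) _ _ e = codeL-injective (inK a) (inC b) (double-injective (suc-injective e))
    code-injective (inK a) (inK b) _ _ e = codeL-injective (inK a) (inK b) (double-injective (suc-injective e))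

    vertex-surjective : ∀ a → a ∈ V Γ₂ → Σ Vertex λ x → Present x × code-⊕L (normal x) ≡ a
    vertex-surjective a a∈ with vertex-cases a∈
    ... | inj₁ (v , v∈ , e) = inB v , v∈ , e
    ... | inj₂ (w , w∈ , e) with ∈-++⁻ (map (2 *_) (X B)) w∈
    ...   | inj₁ w∈X with ∈-map⁻ (2 *_) w∈X
    ...     | v , v∈X , refl = inB v , X⊆V iB v v∈X , trans (sym (image-codeL (inB v) v∈X)) e
    vertex-surjective a a∈ | inj₂ (w , w∈ , e) | inj₂ w∈CK
      with ∈-++⁻ (map (λ v → codeL (normal (inC v))) (VT C)) w∈CK
    ... | inj₁ w∈C with ∈-map⁻ (λ v → codeL (normal (inC v))) w∈C
    ...   | u , u∈ , refl = inC u , u∈ , trans (sym (image-codeL-inC u)) e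
    vertex-surjective a a∈ | inj₂ (w , w∈ , e) | inj₂ w∈CK | inj₂ w∈K
      with ∈-map⁻ (λ v → codeL (normal (inK v))) w∈K
    ... | u , u∈ , refl = inK u , u∈ , trans (sym (image-codeL-inK u)) e

    vertex : ∀ x → Present x → code-⊕L (normal x) ∈ V Γ₂
    vertex (inB v) v∈ = left-vertex v∈
    vertex (inC v) v∈ = subst (_∈ V Γ₂) (image-codeL-inC v)
      (right-vertex (X⊆V iB) (∈-++⁺ʳ (map (2 *_) (X B)) (∈-++⁺ˡ (∈-map⁺ (λ v → codeL (normal (inC v))) v∈))))
    vertex (inK u) u∈ = subst (_∈ V Γ₂) (image-codeL-inK u)
      (right-vertex (X⊆V iB) (∈-++⁺ʳ (map (2 *_) (X B))
        (∈-++⁺ʳ (map (λ v → codeL (normal (inC v))) (VT C)) (∈-map⁺ (λ v → codeL (normal (inK v))) u∈))))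

    edge-surjective : ∀ a b → E Γ₂ a b → Σ Vertex λ x → Σ Vertex λ y → Present x × Present y ×
                      code-⊕L (normal x) ≡ a × code-⊕L (normal y) ≡ b × Adj x y
    edge-surjective a b e with edge-cases e
    ... | inj₁ (u , v , refl , refl , r) =
      inB u , inB v , proj₁ (endpoints B iB r) , proj₂ (endpoints B iB r) , refl , refl , r
    ... | inj₂ (_ , _ , refl , refl , inj₁ (u , v , refl , refl , r)) =
      inC u , inC v , proj₁ (endpoints C iC r) , proj₂ (endpoints C iC r) ,
      sym (image-codeL-inC u) , sym (image-codeL-inC v) , r
    ... | inj₂ (_ , _ , refl , refl , inj₂ (u , v , refl , refl , r)) =
      inK u , inK v , proj₁ (endpoints K iK r) , proj₂ (endpoints K iK r) ,
      sym (image-codeL-inK u) , sym (image-codeL-inK v) , r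

    edge : ∀ x y → Present x → Present y → Adj x y → E Γ₂ (code-⊕L (normal x)) (code-⊕L (normal y))
    edge (inB u) (inB v) _ _ r = left-edge r
    edge (inC u) (inC v) _ _ r =
      subst₂ (E Γ₂) (image-codeL-inC u) (image-codeL-inC v) (right-edge (inj₁ (u , v , refl , refl , r)))
    edge (inK u) (inK v) _ _ r =
      subst₂ (E Γ₂) (image-codeL-inK u) (image-codeL-inK v) (right-edge (inj₂ (u , v , refl , refl , r)))
    edge (inB _) (inC _) _ _ ()
    edge (inB _) (inK _) _ _ ()
    edge (inC _) (inB _) _ _ ()
    edge (inC _) (inK _) _ _ ()
    edge (inK _) (inB _) _ _ ()
    edge (inK _) (inC _) _ _ ()

    presentation : Presentation
    presentation = record
      { Γ = Γ₂ ; code = code-⊕L ; code-injective = code-injective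
      ; vertex-surjective = vertex-surjective ; vertex = vertex
      ; edge-surjective = edge-surjective ; edge = edge }

  M : TGraph
  M = gluedM B (X C) K

  M-length : length (X M) ≡ length (X C)
  M-length = length-map (2 *_) (X C)

  NotInC : Vertex → Set
  NotInC (inC _) = ⊥
  NotInC _ = ⊤

  normal-inK-NotInC : ∀ u → NotInC (normal (inK u))
  normal-inK-NotInC u with u ∈? X K
  ... | yes _ = tt
  ... | no _ = tt

  codeM-injective : ∀ z w → NotInC z → NotInC w → codeM (X C) z ≡ codeM (X C) w → z ≡ w
  codeM-injective (inB a) (inB b) _ _ e with a ∈? X C | b ∈? X C
  ... | yes _ | yes _ = cong inB (double-injective e)
  ... | yes _ | no _ = ⊥-elim (even≢odd a (2 * b) e)
  ... | no _ | yes _ = ⊥-elim (even≢odd b (2 * a) (sym e))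
  ... | no _ | no _ = cong inB (double-injective (double-injective (suc-injective e)))
  codeM-injective (inB a) (inK b) _ _ e with a ∈? X C
  ... | yes _ = ⊥-elim (even≢odd a (suc (2 * b)) e)
  ... | no _ = ⊥-elim (even≢odd a b (double-injective (suc-injective e)))
  codeM-injective (inK a) (inB b) _ _ e with b ∈? X C
  ... | yes _ = ⊥-elim (even≢odd b (suc (2 * a)) (sym e))
  ... | no _ = ⊥-elim (even≢odd b a (double-injective (suc-injective (sym e))))
  codeM-injective (inK a) (inK b) _ _ e =
    cong inK (double-injective (suc-injective (double-injective (suc-injective e))))

  M-isTGraph : IsTGraph M
  M-isTGraph = record
    { isGraph = record { E-sym = symmetric ; E-irrefl = irreflexive ; E-V = λ _ _ → endpoints-M }
    ; X⊆V = λ _ → ∈-++⁺ˡ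
    ; X-uniq = map⁺ double-injective (X-uniq iC) }
    where
    symmetric : ∀ a b → ET M a b → ET M b a
    symmetric a b (inj₁ (u , v , ea , eb , r)) = inj₁ (v , u , eb , ea , E-sym (isGraph iB) u v r)
    symmetric a b (inj₂ (u , v , ea , eb , r)) = inj₂ (v , u , eb , ea , E-sym (isGraph iK) u v r)
    irreflexive : ∀ a → ¬ ET M a a
    irreflexive a (inj₁ (u , v , ea , eb , r)) = E-irrefl (isGraph iB) v
      (subst (λ z → ET B z v) (inB-injective (codeM-injective (inB u) (inB v) tt tt (trans ea (sym eb)))) r)
    irreflexive a (inj₂ (u , v , ea , eb , r)) = E-irrefl (isGraph iK) v
      (subst (λ z → ET K z v) (normal-inK-injective u v
        (codeM-injective _ _ (normal-inK-NotInC u) (normal-inK-NotInC v) (trans ea (sym eb)))) r)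
    fromB : ∀ {u} → u ∈ VT B → codeM (X C) (inB u) ∈ VT M
    fromB u∈ = ∈-++⁺ʳ (map (2 *_) (X C)) (∈-++⁺ˡ (∈-map⁺ (λ v → codeM (X C) (inB v)) u∈))
    fromK : ∀ {u} → u ∈ VT K → codeM (X C) (normal (inK u)) ∈ VT M
    fromK u∈ = ∈-++⁺ʳ (map (2 *_) (X C))
      (∈-++⁺ʳ (map (λ v → codeM (X C) (inB v)) (VT B)) (∈-map⁺ (λ v → codeM (X C) (normal (inK v))) u∈))
    endpoints-M : ∀ {a b} → ET M a b → (a ∈ VT M) × (b ∈ VT M)
    endpoints-M (inj₁ (u , v , refl , refl , r)) = fromB (proj₁ (endpoints B iB r)) , fromB (proj₂ (endpoints B iB r))
    endpoints-M (inj₂ (u , v , refl , refl , r)) = fromK (proj₁ (endpoints K iK r)) , fromK (proj₂ (endpoints K iK r))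

  module RightGlue (B∩XC⊆XB : ∀ v → v ∈ VT B → v ∈ X C → v ∈ X B)
                   (C∩XB⊆XC : ∀ v → v ∈ VT C → v ∈ X B → v ∈ X C) where
    open ⊕-Structure C M (X-uniq M-isTGraph) M-length

    Γ₃ : Graph
    Γ₃ = C ⊕ M

    code : Vertex → ℕ
    code = code-⊕M (X C)

    image-codeM-inB : ∀ v → image (codeM (X C) (inB v)) ≡ code (inB v)
    image-codeM-inB v with v ∈? X C
    ... | yes v∈ = rightImage-double (X C) v∈
    ... | no _ = rightImage-odd (X C) (2 * v)

    image-codeM-inK : ∀ u → image (codeM (X C) (normal (inK u))) ≡ code (normal (inK u))
    image-codeM-inK u with u ∈? X K
    ... | yes _ = image-codeM-inB _
    ... | no _ = rightImage-odd (X C) (suc (2 * u))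

    code-inB-∈ : ∀ {v} → v ∈ X C → code (inB v) ≡ 2 * v
    code-inB-∈ {v} v∈ with v ∈? X C
    ... | yes _ = refl
    ... | no v∉ = ⊥-elim (v∉ v∈)

    code-normal-inC : ∀ {v} → v ∈ VT C → code (normal (inC v)) ≡ 2 * v
    code-normal-inC {v} v∈ with v ∈? X B
    ... | yes v∈X = code-inB-∈ (C∩XB⊆XC v v∈ v∈X)
    ... | no _ = refl

    code-injective : ∀ z w → Normal z → Normal w → code z ≡ code w → z ≡ w
    code-injective (inB a) (inB b) _ _ e with a ∈? X C | b ∈? X C
    ... | yes _ | yes _ = cong inB (double-injective e)
    ... | yes _ | no _ = ⊥-elim (even≢odd a (suc (2 * (2 * b))) e)
    ... | no _ | yes _ = ⊥-elim (even≢odd b (suc (2 * (2 * a))) (sym e))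
    ... | no _ | no _ =
      cong inB (double-injective (double-injective (suc-injective (double-injective (suc-injective e)))))
    code-injective (inB a) (inC b) a∈ (b∈ , b∉) e with a ∈? X C
    ... | yes a∈X = ⊥-elim (b∉ (subst (_∈ X B) (double-injective e) (B∩XC⊆XB a a∈ a∈X)))
    ... | no _ = ⊥-elim (even≢odd b (suc (2 * (2 * a))) (sym e))
    code-injective (inB a) (inK b) _ _ e with a ∈? X C
    ... | yes _ = ⊥-elim (even≢odd a (codeL (inK b)) e)
    ... | no _ = ⊥-elim (even≢odd a b (double-injective (suc-injective (double-injective (suc-injective e)))))
    code-injective (inC a) (inB b) na nb e = sym (code-injective (inB b) (inC a) nb na (sym e))
    code-injective (inC a) (inC b) _ _ e = cong inC (double-injective e)
    code-injective (inC a) (inK b) _ _ e = ⊥-elim (even≢odd a (codeL (inK b)) e)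
    code-injective (inK a) (inB b) na nb e = sym (code-injective (inB b) (inK a) nb na (sym e))
    code-injective (inK a) (inC b) _ _ e = ⊥-elim (even≢odd b (codeL (inK a)) (sym e))
    code-injective (inK a) (inK b) _ _ e = codeL-injective (inK a) (inK b) (double-injective (suc-injective e))

    vertex-surjective : ∀ a → a ∈ V Γ₃ → Σ Vertex λ x → Present x × code (normal x) ≡ a
    vertex-surjective a a∈ with vertex-cases a∈
    ... | inj₁ (v , v∈ , e) = inC v , v∈ , trans (code-normal-inC v∈) e
    ... | inj₂ (w , w∈ , e) with ∈-++⁻ (map (2 *_) (X C)) w∈
    ...   | inj₁ w∈X with ∈-map⁻ (2 *_) w∈X
    ...     | v , v∈X , refl = inC v , X⊆V iC v v∈X ,
                trans (code-normal-inC (X⊆V iC v v∈X)) (trans (sym (rightImage-double (X C) v∈X)) e)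
    vertex-surjective a a∈ | inj₂ (w , w∈ , e) | inj₂ w∈BK
      with ∈-++⁻ (map (λ v → codeM (X C) (inB v)) (VT B)) w∈BK
    ... | inj₁ w∈B with ∈-map⁻ (λ v → codeM (X C) (inB v)) w∈B
    ...   | u , u∈ , refl = inB u , u∈ , trans (sym (image-codeM-inB u)) e
    vertex-surjective a a∈ | inj₂ (w , w∈ , e) | inj₂ w∈BK | inj₂ w∈K
      with ∈-map⁻ (λ v → codeM (X C) (normal (inK v))) w∈K
    ... | u , u∈ , refl = inK u , u∈ , trans (sym (image-codeM-inK u)) e

    vertex : ∀ x → Present x → code (normal x) ∈ V Γ₃
    vertex (inC v) v∈ = subst (_∈ V Γ₃) (sym (code-normal-inC v∈)) (left-vertex v∈)
    vertex (inB v) v∈ = subst (_∈ V Γ₃) (image-codeM-inB v)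
      (right-vertex (X⊆V iC) (∈-++⁺ʳ (map (2 *_) (X C)) (∈-++⁺ˡ (∈-map⁺ (λ v → codeM (X C) (inB v)) v∈))))
    vertex (inK u) u∈ = subst (_∈ V Γ₃) (image-codeM-inK u)
      (right-vertex (X⊆V iC) (∈-++⁺ʳ (map (2 *_) (X C))
        (∈-++⁺ʳ (map (λ v → codeM (X C) (inB v)) (VT B)) (∈-map⁺ (λ v → codeM (X C) (normal (inK v))) u∈))))

    edge-surjective : ∀ a b → E Γ₃ a b → Σ Vertex λ x → Σ Vertex λ y → Present x × Present y ×
                      code (normal x) ≡ a × code (normal y) ≡ b × Adj x y
    edge-surjective a b e with edge-cases e
    ... | inj₁ (u , v , refl , refl , r) =
      let (u∈ , v∈) = endpoints C iC r
      in inC u , inC v , u∈ , v∈ , code-normal-inC u∈ , code-normal-inC v∈ , r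
    ... | inj₂ (_ , _ , refl , refl , inj₁ (u , v , refl , refl , r)) =
      inB u , inB v , proj₁ (endpoints B iB r) , proj₂ (endpoints B iB r) ,
      sym (image-codeM-inB u) , sym (image-codeM-inB v) , r
    ... | inj₂ (_ , _ , refl , refl , inj₂ (u , v , refl , refl , r)) =
      inK u , inK v , proj₁ (endpoints K iK r) , proj₂ (endpoints K iK r) ,
      sym (image-codeM-inK u) , sym (image-codeM-inK v) , r

    edge : ∀ x y → Present x → Present y → Adj x y → E Γ₃ (code (normal x)) (code (normal y))
    edge (inC u) (inC v) u∈ v∈ r =
      subst₂ (E Γ₃) (sym (code-normal-inC u∈)) (sym (code-normal-inC v∈)) (left-edge r)
    edge (inB u) (inB v) _ _ r =
      subst₂ (E Γ₃) (image-codeM-inB u) (image-codeM-inB v) (right-edge (inj₁ (u , v , refl , refl , r)))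
    edge (inK u) (inK v) _ _ r =
      subst₂ (E Γ₃) (image-codeM-inK u) (image-codeM-inK v) (right-edge (inj₂ (u , v , refl , refl , r)))
    edge (inB _) (inC _) _ _ ()
    edge (inB _) (inK _) _ _ ()
    edge (inC _) (inB _) _ _ ()
    edge (inC _) (inK _) _ _ ()
    edge (inK _) (inB _) _ _ ()
    edge (inK _) (inC _) _ _ ()

    presentation : Presentation
    presentation = record
      { Γ = Γ₃ ; code = code ; code-injective = code-injective
      ; vertex-surjective = vertex-surjective ; vertex = vertex
      ; edge-surjective = edge-surjective ; edge = edge }

  ⊕▷⊕⇔⊕L : ∀ {P} → GraphProperty P → (∀ v → v ∈ VT B → v ∈ VT C → v ∈ X B) →
           P ((B ⊕▷ C) ⊕ K) ⇔ P (B ⊕ L)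
  ⊕▷⊕⇔⊕L isProp B∩C⊆XB = presentations-⇔ isProp (Union.presentation B∩C⊆XB) LeftGlue.presentation

  ⊕L⇔⊕M : ∀ {P} → GraphProperty P →
          (∀ v → v ∈ VT B → v ∈ X C → v ∈ X B) → (∀ v → v ∈ VT C → v ∈ X B → v ∈ X C) →
          P (B ⊕ L) ⇔ P (C ⊕ M)
  ⊕L⇔⊕M isProp B∩XC⊆XB C∩XB⊆XC =
    presentations-⇔ isProp LeftGlue.presentation (RightGlue.presentation B∩XC⊆XB C∩XB⊆XC)

∼-⊕▷-congruent : ∀ {P} → GraphProperty P → (B C B′ C′ : TGraph) →
                 IsTGraph B → IsTGraph C → IsTGraph B′ → IsTGraph C′ →
                 B′ ∼[ P ] B → C′ ∼[ P ] C → X B′ ≡ X B → X C′ ≡ X C →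
                 (∀ v → v ∈ VT B → v ∈ VT C → v ∈ X B) →
                 (∀ v → v ∈ VT C → v ∈ X B → v ∈ X C) →
                 (∀ v → v ∈ VT B′ → v ∈ VT C′ → v ∈ X B′ × v ∈ X C′) →
                 (B ⊕▷ C) ∼[ P ] (B′ ⊕▷ C′)
∼-⊕▷-congruent {P} isProp B C record { graph = b′ ; X = .(X B) } record { graph = c′ ; X = .(X C) }
               iB iC iB′ iC′ (_ , B′∼B) (_ , C′∼C) refl refl B∩C⊆XB C∩XB⊆XC B′∩C′⊆X = refl , equivalent
  where
  B′ = record { graph = b′ ; X = X B }
  C′ = record { graph = c′ ; X = X C }
  open IsTGraph
  open Relation.Binary.Reasoning.Setoid (⇔-setoid 0ℓ)

  equivalent : ∀ K → IsTGraph K → length (X K) ≡ length (X B) → P ((B ⊕▷ C) ⊕ K) ⇔ P ((B′ ⊕▷ C′) ⊕ K)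
  equivalent K iK len = begin
    P ((B ⊕▷ C) ⊕ K)    ≈⟨ BC.⊕▷⊕⇔⊕L isProp B∩C⊆XB ⟩
    P (B ⊕ BC.L)         ≈⟨ B′∼B BC.L BC.L-isTGraph BC.L-length ⟨
    P (B′ ⊕ B′C.L)       ≈⟨ B′C.⊕L⇔⊕M isProp (λ v v∈ v∈X → proj₁ (B′∩C′⊆X v v∈ (X⊆V iC′ v v∈X))) C∩XB⊆XC ⟩
    P (C ⊕ B′C.M)        ≈⟨ C′∼C B′C.M B′C.M-isTGraph B′C.M-length ⟨
    P (C′ ⊕ B′C′.M)      ≈⟨ B′C′.⊕L⇔⊕M isProp (λ v v∈ v∈X → proj₁ (B′∩C′⊆X v v∈ (X⊆V iC′ v v∈X)))
                                              (λ v v∈ v∈X → proj₂ (B′∩C′⊆X v (X⊆V iB′ v v∈X) v∈)) ⟨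
    P (B′ ⊕ B′C′.L)      ≈⟨ B′C′.⊕▷⊕⇔⊕L isProp (λ v v∈ v∈′ → proj₁ (B′∩C′⊆X v v∈ v∈′)) ⟨
    P ((B′ ⊕▷ C′) ⊕ K)  ∎
    where
    module BC   = Gluing B C K iB iC iK len
    module B′C  = Gluing B′ C K iB′ iC iK len
    module B′C′ = Gluing B′ C′ K iB′ iC′ iK len

∋-trans : ∀ {T t s p q} → T ∋ t at p → t ∋ s at q → T ∋ s at (p ++ q)
∋-trans here s∈t = s∈t
∋-trans (there i t∈T) s∈t = there i (∋-trans t∈T s∈t)

verts⇒bag : ∀ t {v} → v ∈ verts t → ∃ λ r → ∃ λ s → t ∋ s at r × v ∈ bag s
vertsL⇒bag : ∀ cs {v} → v ∈ vertsL cs →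
             ∃ λ (i : Fin (length cs)) → ∃ λ r → ∃ λ s → lookup cs i ∋ s at r × v ∈ bag s
verts⇒bag (node b cs) v∈ with ∈-++⁻ b v∈
... | inj₁ v∈b = [] , node b cs , here , v∈b
... | inj₂ v∈cs with vertsL⇒bag cs v∈cs
...   | i , r , s , s∈ , v∈s = toℕ i ∷ r , s , there i s∈ , v∈s
vertsL⇒bag (c ∷ cs) v∈ with ∈-++⁻ (verts c) v∈
... | inj₁ v∈c = fzero , verts⇒bag c v∈c
... | inj₂ v∈cs with vertsL⇒bag cs v∈cs
...   | i , found = fsuc i , found

∈-vertsL-take⁻ : ∀ k cs {v} → v ∈ vertsL (take k cs) →
                 ∃ λ (i : Fin (length cs)) → toℕ i < k × v ∈ verts (lookup cs i)
∈-vertsL-take⁻ (suc k) (c ∷ cs) v∈ with ∈-++⁻ (verts c) v∈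
... | inj₁ v∈c = fzero , s≤s z≤n , v∈c
... | inj₂ v∈cs with ∈-vertsL-take⁻ k cs v∈cs
...   | i , i<k , v∈i = fsuc i , s≤s i<k , v∈i

⊑-diverging : ∀ (s p : Path) {i j r₁ r₂} → i ≢ j → s ⊑ (p ++ i ∷ r₁) → s ⊑ (p ++ j ∷ r₂) → s ⊑ p
⊑-diverging [] p _ _ _ = p , refl
⊑-diverging (x ∷ s) [] i≢j (_ , e₁) (_ , e₂) = ⊥-elim (i≢j (trans (sym (∷-injectiveˡ e₁)) (∷-injectiveˡ e₂)))
⊑-diverging (x ∷ s) (y ∷ p) i≢j (r₁ , e₁) (r₂ , e₂)
  with ⊑-diverging s p i≢j (r₁ , ∷-injectiveʳ e₁) (r₂ , ∷-injectiveʳ e₂)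
... | r , e = r , cong₂ _∷_ (∷-injectiveˡ e₁) e

induced-isTGraph : ∀ {Γ} → IsGraph Γ → ∀ {S Y} → Unique Y → (∀ v → v ∈ Y → v ∈ S) → IsTGraph (induced Γ S Y)
induced-isTGraph isG Y-unique Y⊆S = record
  { isGraph = record
    { E-sym = λ u v (u∈ , v∈ , e) → v∈ , u∈ , IsGraph.E-sym isG u v e
    ; E-irrefl = λ v (_ , _ , e) → IsGraph.E-irrefl isG v e
    ; E-V = λ u v (u∈ , v∈ , _) → u∈ , v∈ }
  ; X⊆V = Y⊆S
  ; X-uniq = Y-unique }

module _ {Γ : Graph} {T : Tree} (td : TreeDecomposition Γ T) where
  open TreeDecomposition td

  tsg-isTGraph : IsGraph Γ → ∀ {t p} → T ∋ t at p → IsTGraph (tsg Γ t)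
  tsg-isTGraph isG {node b cs} {p} t∈ = induced-isTGraph isG (bag-uniq _ p t∈) (λ _ → ∈-++⁺ˡ)

  ptsg-isTGraph : IsGraph Γ → ∀ {t p} → T ∋ t at p → ∀ j → IsTGraph (ptsg Γ t j)
  ptsg-isTGraph isG {node b cs} {p} t∈ j = induced-isTGraph isG (bag-uniq _ p t∈) (λ _ → ∈-++⁺ˡ)

  -- A vertex of an earlier sibling's subtree and of the j-th child's subtree lies on both sides of the
  -- parent, hence in its bag by the connectivity axiom.
  ptsg∩tsg⊆bag : ∀ {t p} → T ∋ t at p → ∀ j v →
                 v ∈ VT (ptsg Γ t j) → v ∈ VT (tsg Γ (lookup (children t) j)) → v ∈ bag t
  ptsg∩tsg⊆bag {node b cs} {p} t∈ j v v∈G v∈H with ∈-++⁻ b v∈G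
  ... | inj₁ v∈b = v∈b
  ... | inj₂ v∈sib with ∈-vertsL-take⁻ (toℕ j) cs v∈sib
  ...   | i , i<j , v∈i with verts⇒bag (lookup cs i) v∈i | verts⇒bag (lookup cs j) v∈H
  ...     | r₁ , s₁ , s₁∈ , v∈s₁ | r₂ , s₂ , s₂∈ , v∈s₂ =
    connected v (p ++ toℕ i ∷ r₁) (p ++ toℕ j ∷ r₂) p s₁ s₂ (node b cs)
      (∋-trans t∈ (there i s₁∈)) (∋-trans t∈ (there j s₂∈)) t∈ v∈s₁ v∈s₂
      (inj₁ (toℕ i ∷ r₁ , refl) , λ s s⊑₁ s⊑₂ → ⊑-diverging s p (<⇒≢ i<j) s⊑₁ s⊑₂)

  tsg∩bag⊆child-bag : ∀ {t p} → T ∋ t at p → ∀ j v →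
                      v ∈ VT (tsg Γ (lookup (children t) j)) → v ∈ bag t → v ∈ bag (lookup (children t) j)
  tsg∩bag⊆child-bag {node b cs} {p} t∈ j v v∈H v∈b with verts⇒bag (lookup cs j) v∈H
  ... | r , s , s∈ , v∈s =
    connected v p (p ++ toℕ j ∷ r) (p ++ toℕ j ∷ []) (node b cs) s (lookup cs j)
      t∈ (∋-trans t∈ (there j s∈)) (∋-trans t∈ (there j here)) v∈b v∈s
      (inj₂ (r , ++-assoc p (toℕ j ∷ []) r) ,
       λ s (r′ , e) _ → r′ ++ toℕ j ∷ [] , trans (sym (++-assoc s r′ (toℕ j ∷ []))) (cong (_++ toℕ j ∷ []) e))

lemma1 : (P : Graph → Set) → GraphProperty P →
    (Γ : Graph) → IsGraph Γ → (T : Tree) → TreeDecomposition Γ T →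
    (t : Tree) (p : Path) → T ∋ t at p → 1 < length (children t) →
    (j : Fin (length (children t))) →
    (G′ H′ : TGraph) → IsTGraph G′ → IsTGraph H′ →
    G′ ∼[ P ] ptsg Γ t j → H′ ∼[ P ] tsg Γ (lookup (children t) j) →
    X G′ ≡ X (ptsg Γ t j) → X H′ ≡ X (tsg Γ (lookup (children t) j)) →
    (∀ v → v ∈ VT G′ → v ∈ VT H′ → v ∈ X G′ × v ∈ X H′) →
    (ptsg Γ t j ⊕▷ tsg Γ (lookup (children t) j)) ∼[ P ] (G′ ⊕▷ H′)
lemma1 P isProp Γ isG T td t p t∈ _ j G′ H′ iG′ iH′ G′∼G H′∼H XG′ XH′ G′∩H′⊆X =
  ∼-⊕▷-congruent isProp (ptsg Γ t j) (tsg Γ (lookup (children t) j)) G′ H′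
    (ptsg-isTGraph td isG t∈ j) (tsg-isTGraph td isG (∋-trans t∈ (child∈ t j)))
    iG′ iH′ G′∼G H′∼H XG′ XH′
    (ptsg∩tsg⊆bag td t∈ j) (tsg∩bag⊆child-bag td t∈ j) G′∩H′⊆X
  where
  child∈ : ∀ t j → t ∋ lookup (children t) j at (toℕ j ∷ [])
  child∈ (node b cs) j = there j here
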